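{- Consider the LMES Algorithm (described in the context) run on a network with $n$ nodes. During any single $\Delta$-scaling phase, the total amount of flow sent in pushes is less than $2n^2\Delta$.
   Context: Network: directed graph $G=(N,A)$, $n=|N|$, $m=|A|$, source $s$, sink $t$, non-negative integer arc capacities $u_{ij}$ with largest capacity $U$. Standing assumptions: there is at most one arc from $i$ to $j$; for every $(i,j)\in A$ also $(j,i)\in A$ (possibly with capacity $0$); for every node $j\ne s,t$ there are arcs $(j,s)$ and $(t,j)$ with capacity $U$. For $x:A\to\mathbb{R}$ with $0\le x\le u$, the excess of node $i$ is $e(i)=\sum_{(j,i)\in A}x_{ji}-\sum_{(i,j)\in A}x_{ij}$; $x$ is a preflow if $e(i)\ge 0$ for all $i\ne s$. The residual capacity is $r_{ij}=u_{ij}+x_{ji}-x_{ij}$; sending $\delta\le r_{ij}$ units from $i$ to $j$ means decreasing $x_{ji}$ by $\min\{\delta,x_{ji}\}$ and increasing $x_{ij}$ by the rest. Each node has an integer distance label $d(i)$; arc $(i,j)$ is admissible if $r_{ij}>0$ and $d(i)=d(j)+1$. LMES Algorithm with scaling factor $k$ (a power of $2$): Initially $x_{si}=u_{si}$ for arcs out of $s$ and $x=0$ elsewhere, $d(s)=n$, $d(i)=0$ for $i\ne s$, and $\Delta$ is the least power of $2$ exceeding $U$. In the $\Delta$-scaling phase, a node $i\in N\setminus\{s,t\}$ has large excess if $e(i)\ge\Delta/2$ and medium excess if $\Delta/k\le e(i)<\Delta/2$. Repeat: if no node has large or medium excess, the phase ends, $\Delta$ is replaced by $\Delta/k$, and the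 algorithm stops if $\Delta<1$; otherwise select $i$ = a large-excess node of minimum $d(i)$ if one exists, else a medium-excess node of maximum $d(i)$. If there is an admissible arc $(i,j)$, push: send $\delta=\min\{e(i),r_{ij},\Delta-e(j)\}$ units from $i$ to $j$ (the term $\Delta-e(j)$ is omitted when $j\in\{s,t\}$); otherwise relabel: $d(i):=d(i)+1$. -}

module Defs where

open import Data.Bool using (Bool; true; false; if_then_else_)
open import Data.Nat as ℕ using (ℕ; zero; suc; _+_; _*_; _∸_; _^_; _≤_; _<_; _⊔_)
open import Data.Integer as ℤ using (ℤ; +_; _-_; _⊓_)
open import Data.Fin using (Fin; _≟_)
open import Data.List using (List; foldr; map; allFin)
open import Data.Nat.ListAction using (sum)
open import Data.Product using (Σ; _×_; _,_)
open import Data.Sum using (_⊎_)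
open import Relation.Nullary using (¬_)
open import Relation.Nullary.Decidable using (⌊_⌋)
open import Relation.Binary.PropositionalEquality using (_≡_; _≢_)

-- Networks.  Nodes are Fin n.  The arc set A is given by a Boolean
-- predicate 'arc' (so there is at most one arc from i to j);
-- capacities u i j are only meaningful when arc i j ≡ true.

record Network (n : ℕ) : Set where
  field
    s t   : Fin n
    s≢t   : s ≢ t
    arc   : Fin n → Fin n → Bool
    u     : Fin n → Fin n → ℕ

  cap : Fin n → Fin n → ℕ
  cap i j = if arc i j then u i j else 0

  U : ℕ
  U = foldr (λ i acc → foldr (λ j acc' → cap i j ⊔ acc') acc (allFin n)) 0 (allFin n)

  field
    arc-sym : ∀ i j → arc i j ≡ true → arc j i ≡ true
    arc-to-s    : ∀ j → j ≢ s → j ≢ t → arc j s ≡ true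
    cap-to-s    : ∀ j → j ≢ s → j ≢ t → u j s ≡ U
    arc-from-t  : ∀ j → j ≢ s → j ≢ t → arc t j ≡ true
    cap-from-t  : ∀ j → j ≢ s → j ≢ t → u t j ≡ U

-- The LMES algorithm with scaling factor k, as a nondeterministic
-- transition system (ties in the node selection and the choice of the
-- admissible arc are arbitrary).

record State (n : ℕ) : Set where
  constructor ⟨_,_,_⟩
  field
    x : Fin n → Fin n → ℕ     -- flow (only used on arcs)
    d : Fin n → ℕ
    Δ : ℕ
open State public

_==_ : ∀ {n} → Fin n → Fin n → Bool
i == j = ⌊ i ≟ j ⌋

module LMES {n : ℕ} (N : Network n) (k : ℕ) where
  open Network N

  inflow : (Fin n → Fin n → ℕ) → Fin n → ℕ
  inflow x i = sum (map (λ j → if arc j i then x j i else 0) (allFin n))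

  outflow : (Fin n → Fin n → ℕ) → Fin n → ℕ
  outflow x i = sum (map (λ j → if arc i j then x i j else 0) (allFin n))

  excess : (Fin n → Fin n → ℕ) → Fin n → ℤ
  excess x i = + inflow x i - + outflow x i

  -- residual capacity r_ij = u_ij + x_ji - x_ij  (for arcs; x ≤ u)
  res : (Fin n → Fin n → ℕ) → Fin n → Fin n → ℕ
  res x i j = (u i j + x j i) ∸ x i j

  send : (Fin n → Fin n → ℕ) → Fin n → Fin n → ℕ → (Fin n → Fin n → ℕ)
  send x i j δ a b =
    if (a == j) Data.Bool.∧ (b == i) then x j i ∸ δ
    else if (a == i) Data.Bool.∧ (b == j) then x i j + (δ ∸ x j i)
    else x a b

  relabelAt : (Fin n → ℕ) → Fin n → (Fin n → ℕ)
  relabelAt d i a = if a == i then suc (d i) else d a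

  Large : State n → Fin n → Set
  Large σ i = i ≢ s × i ≢ t × (+ Δ σ ℤ.≤ + 2 ℤ.* excess (x σ) i)

  Medium : State n → Fin n → Set
  Medium σ i = i ≢ s × i ≢ t × (+ Δ σ ℤ.≤ + k ℤ.* excess (x σ) i)
                              × (+ 2 ℤ.* excess (x σ) i ℤ.< + Δ σ)

  Selected : State n → Fin n → Set
  Selected σ i =
      (Large σ i × (∀ j → Large σ j → d σ i ≤ d σ j))
    ⊎ (Medium σ i × (∀ j → ¬ Large σ j) × (∀ j → Medium σ j → d σ j ≤ d σ i))

  Admissible : State n → Fin n → Fin n → Set
  Admissible σ i j = arc i j ≡ true × 0 < res (x σ) i j × d σ i ≡ suc (d σ j)

  pushAmount : State n → Fin n → Fin n → ℤ
  pushAmount σ i j =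
    if (j == s) Data.Bool.∨ (j == t)
    then excess (x σ) i ⊓ + res (x σ) i j
    else excess (x σ) i ⊓ + res (x σ) i j ⊓ (+ Δ σ - excess (x σ) j)

  data Step : State n → State n → ℕ → Set where
    push    : ∀ σ i j (δ : ℕ) → Selected σ i → Admissible σ i j →
              + δ ≡ pushAmount σ i j →
              Step σ ⟨ send (x σ) i j δ , d σ , Δ σ ⟩ δ
    relabel : ∀ σ i → Selected σ i → (∀ j → ¬ Admissible σ i j) →
              Step σ ⟨ x σ , relabelAt (d σ) i , Δ σ ⟩ 0

  data Steps : State n → State n → ℕ → Set where
    done : ∀ σ → Steps σ σ 0
    _∷_  : ∀ {σ σ' σ'' a b} → Step σ σ' a → Steps σ' σ'' b → Steps σ σ'' (a + b)

  -- end of phase: no large or medium excess node; Δ := Δ/k, and the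
  -- algorithm continues only if the new Δ is ≥ 1 (Δ and k are powers of 2,
  -- so Δ/k is then the natural number Δ' with k * Δ' ≡ Δ)
  data EndPhase : State n → State n → Set where
    endPhase : ∀ σ Δ' → (∀ i → ¬ Large σ i) → (∀ i → ¬ Medium σ i) →
               k * Δ' ≡ Δ σ → 1 ≤ Δ' →
               EndPhase σ ⟨ x σ , d σ , Δ' ⟩

  LeastPow2Above : ℕ → ℕ → Set
  LeastPow2Above m Δ₀ = Σ ℕ λ q → Δ₀ ≡ 2 ^ q × m < Δ₀ × (∀ q' → m < 2 ^ q' → Δ₀ ≤ 2 ^ q')

  initialFlow : Fin n → Fin n → ℕ
  initialFlow i j = if (i == s) Data.Bool.∧ arc i j then u i j else 0

  initialLabel : Fin n → ℕ
  initialLabel i = if i == s then n else 0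

  Initial : State n → Set
  Initial σ = x σ ≡ initialFlow × d σ ≡ initialLabel × LeastPow2Above U (Δ σ)

  data Reachable : State n → Set where
    init  : ∀ σ → Initial σ → Reachable σ
    step  : ∀ {σ σ' a} → Reachable σ → Step σ σ' a → Reachable σ'
    phase : ∀ {σ σ'} → Reachable σ → EndPhase σ σ' → Reachable σ'

  data PhaseStart : State n → Set where
    first : ∀ σ → Initial σ → PhaseStart σ
    next  : ∀ {σ σ'} → Reachable σ → EndPhase σ σ' → PhaseStart σ'

module Submission where

-- Let Φ = Σ e(i)·d(i) and Λ = Σ d(i), both summed over the nodes other than s and t.
-- A push of δ along an admissible arc (d(i) = d(j) + 1) lowers Φ by at least δ, and a
-- relabel raises Φ by e(i) ≤ Δ and Λ by 1.  Hence the flow pushed during a phase is at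
-- most Φ_start − Φ_end + Δ·(Λ_end − Λ_start) ≤ Δ·Λ_end, because 0 ≤ Φ ≤ Δ·Λ: the excess
-- of every inner node stays in [0, Δ] (a push into j is capped by Δ − e(j), and a phase
-- ends only when all excesses are below the next Δ).  Finally labels stay ≤ 2n: a node
-- with positive excess has d(i) < 2n, for otherwise some level between d(s) = n and d(i)
-- is empty, and the nodes above it would form a set that no residual arc leaves but
-- that holds positive excess, which flow conservation forbids.  So Λ ≤ 2n(n − 1), and the
-- pushed flow is below 2n²Δ.

open import Defs

module FinSumℤ where

  open import Data.Bool using (true; false; if_then_else_)
  open import Data.Nat using (zero; suc)
  open import Data.Integer as ℤ using (ℤ; +_; _+_; _-_; -_; _*_; 0ℤ; _≤_)
  import Data.Integer.Properties as ℤP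
  open import Data.Integer.Tactic.RingSolver using (solve-∀)
  open import Data.Fin using (Fin; zero; suc)
  open import Function using (_∘_)
  import Data.Fin.Properties as FinP
  open import Relation.Nullary using (contradiction)
  open import Relation.Binary.PropositionalEquality
  open import Algebra.Properties.Semiring.Sum ℤP.+-*-semiring
    using (sum; sum-syntax; sum-cong-≗; sum-replicate-zero; ∑-distrib-+; ∑-comm)

  ∑-mono-≤ : ∀ {m} {f g : Fin m → ℤ} → (∀ a → f a ≤ g a) → ∑[ a < m ] f a ≤ ∑[ a < m ] g a
  ∑-mono-≤ {zero}  f≤g = ℤP.≤-refl
  ∑-mono-≤ {suc m} f≤g = ℤP.+-mono-≤ (f≤g zero) (∑-mono-≤ (f≤g ∘ suc))

  ∑-nonNeg : ∀ {m} {f : Fin m → ℤ} → (∀ a → 0ℤ ≤ f a) → 0ℤ ≤ ∑[ a < m ] f a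
  ∑-nonNeg {m} {f} 0≤f = subst (_≤ sum f) (sum-replicate-zero m) (∑-mono-≤ 0≤f)

  ∑-nonPos : ∀ {m} {f : Fin m → ℤ} → (∀ a → f a ≤ 0ℤ) → ∑[ a < m ] f a ≤ 0ℤ
  ∑-nonPos {m} {f} f≤0 = subst (sum f ≤_) (sum-replicate-zero m) (∑-mono-≤ f≤0)

  ∑-neg : ∀ {m} (f : Fin m → ℤ) → ∑[ a < m ] (- f a) ≡ - ∑[ a < m ] f a
  ∑-neg {zero}  f = refl
  ∑-neg {suc m} f = trans (cong (_+_ (- f zero)) (∑-neg (f ∘ suc))) (sym (ℤP.neg-distrib-+ (f zero) _))

  ∑-sub : ∀ {m} (f g : Fin m → ℤ) → ∑[ a < m ] (f a - g a) ≡ ∑[ a < m ] f a - ∑[ a < m ] g a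
  ∑-sub f g = trans (∑-distrib-+ f (-_ ∘ g)) (cong (_+_ (sum f)) (∑-neg g))

  ∑-antisym≡0 : ∀ {m} (h : Fin m → Fin m → ℤ) → (∀ a b → h a b ≡ - h b a) →
                ∑[ a < m ] ∑[ b < m ] h a b ≡ 0ℤ
  ∑-antisym≡0 {m} h anti = self-neg⇒0 (begin
    ∑[ a < m ] ∑[ b < m ] h a b    ≡⟨ ∑-comm h ⟩
    ∑[ b < m ] ∑[ a < m ] h a b    ≡⟨ sum-cong-≗ (λ b → sum-cong-≗ (λ a → anti a b)) ⟩
    ∑[ b < m ] ∑[ a < m ] (- h b a) ≡⟨ sum-cong-≗ (λ b → ∑-neg (h b)) ⟩
    ∑[ b < m ] (- ∑[ a < m ] h b a) ≡⟨ ∑-neg (λ b → sum (h b)) ⟩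
    - ∑[ b < m ] ∑[ a < m ] h b a  ∎)
    where
    open ≡-Reasoning
    self-neg⇒0 : ∀ {z} → z ≡ - z → z ≡ 0ℤ
    self-neg⇒0 {+ zero}  _  = refl
    self-neg⇒0 {+ suc _} ()
    self-neg⇒0 {ℤ.-[1+ _ ]} ()

  ∑-single : ∀ {m} (f : Fin m → ℤ) i → (∀ b → b ≢ i → f b ≡ 0ℤ) → ∑[ b < m ] f b ≡ f i
  ∑-single {suc m} f zero vanish = begin
    f zero + ∑[ b < m ] f (suc b)  ≡⟨ cong (_+_ (f zero)) (sum-cong-≗ (λ b → vanish (suc b) λ ())) ⟩
    f zero + ∑[ b < m ] 0ℤ         ≡⟨ cong (_+_ (f zero)) (sum-replicate-zero m) ⟩
    f zero + 0ℤ                    ≡⟨ ℤP.+-identityʳ (f zero) ⟩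
    f zero                         ∎
    where open ≡-Reasoning
  ∑-single {suc m} f (suc i) vanish =
    trans (cong₂ _+_ (vanish zero λ ())
                     (∑-single (f ∘ suc) i (λ b b≢i → vanish (suc b) (b≢i ∘ FinP.suc-injective))))
          (ℤP.+-identityˡ (f (suc i)))

  ∑-pair : ∀ {m} (f : Fin m → ℤ) {i j} → i ≢ j → (∀ b → b ≢ i → b ≢ j → f b ≡ 0ℤ) →
           ∑[ b < m ] f b ≡ f i + f j
  ∑-pair f {zero}  {zero}  i≢j vanish = contradiction refl i≢j
  ∑-pair f {zero}  {suc j} i≢j vanish =
    cong (_+_ (f zero)) (∑-single (f ∘ suc) j (λ b b≢j → vanish (suc b) (λ ()) (b≢j ∘ FinP.suc-injective)))
  ∑-pair f {suc i} {zero}  i≢j vanish =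
    trans (cong (_+_ (f zero))
                (∑-single (f ∘ suc) i (λ b b≢i → vanish (suc b) (b≢i ∘ FinP.suc-injective) (λ ()))))
          (ℤP.+-comm (f zero) (f (suc i)))
  ∑-pair f {suc i} {suc j} i≢j vanish =
    trans (cong₂ _+_ (vanish zero (λ ()) (λ ())) (∑-pair (f ∘ suc) (i≢j ∘ cong suc)
            (λ b b≢i b≢j → vanish (suc b) (b≢i ∘ FinP.suc-injective) (b≢j ∘ FinP.suc-injective))))
          (ℤP.+-identityˡ _)

  term≤∑ : ∀ {m} {f : Fin m → ℤ} → (∀ a → 0ℤ ≤ f a) → ∀ i → f i ≤ ∑[ a < m ] f a
  term≤∑ {suc m} {f} 0≤f zero = ℤP.≤-trans (ℤP.≤-reflexive (sym (ℤP.+-identityʳ (f zero))))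
                                           (ℤP.+-monoʳ-≤ (f zero) (∑-nonNeg (0≤f ∘ suc)))
  term≤∑ {suc m} {f} 0≤f (suc i) =
    ℤP.≤-trans (term≤∑ (0≤f ∘ suc) i) (ℤP.i≤j+i _ (f zero) {{ℤ.nonNegative (0≤f zero)}})

  ∑≤m*c : ∀ {m} {f : Fin m → ℤ} {c} → (∀ a → f a ≤ c) → ∑[ a < m ] f a ≤ + m * c
  ∑≤m*c {zero}  f≤c = ℤP.≤-refl
  ∑≤m*c {suc m} {c = c} f≤c =
    ℤP.≤-trans (ℤP.+-mono-≤ (f≤c zero) (∑≤m*c (f≤c ∘ suc))) (ℤP.≤-reflexive (sym (ℤP.suc-* (+ m) c)))

  ∑+c≤m*c : ∀ {m} {f : Fin m → ℤ} {c} i → f i ≤ 0ℤ → (∀ a → f a ≤ c) →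
            ∑[ a < m ] f a + c ≤ + m * c
  ∑+c≤m*c {suc m} {f} {c} zero fi≤0 f≤c = begin
    f zero + ∑[ a < m ] f (suc a) + c  ≤⟨ ℤP.+-monoˡ-≤ c (ℤP.+-mono-≤ fi≤0 (∑≤m*c (f≤c ∘ suc))) ⟩
    0ℤ + + m * c + c                   ≡⟨ cong (_+ c) (ℤP.+-identityˡ (+ m * c)) ⟩
    + m * c + c                        ≡⟨ ℤP.+-comm (+ m * c) c ⟩
    c + + m * c                        ≡⟨ ℤP.suc-* (+ m) c ⟨
    + suc m * c                        ∎
    where open ℤP.≤-Reasoning
  ∑+c≤m*c {suc m} {f} {c} (suc i) fi≤0 f≤c = begin
    f zero + ∑[ a < m ] f (suc a) + c    ≡⟨ ℤP.+-assoc (f zero) _ c ⟩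
    f zero + (∑[ a < m ] f (suc a) + c)  ≤⟨ ℤP.+-mono-≤ (f≤c zero) (∑+c≤m*c i fi≤0 (f≤c ∘ suc)) ⟩
    c + + m * c                          ≡⟨ ℤP.suc-* (+ m) c ⟨
    + suc m * c                          ∎
    where open ℤP.≤-Reasoning

  ∑-if : ∀ {m} c (f : Fin m → ℤ) → (if c then ∑[ a < m ] f a else 0ℤ) ≡ ∑[ a < m ] (if c then f a else 0ℤ)
  ∑-if {m} true  f = refl
  ∑-if {m} false f = sym (sum-replicate-zero m)

  private
    add-sub-cancel : ∀ x y → x ≡ y + (x - y)
    add-sub-cancel = solve-∀

  ∑-update : ∀ {m} (f g : Fin m → ℤ) i → (∀ b → b ≢ i → g b ≡ f b) →
             ∑[ b < m ] g b ≡ ∑[ b < m ] f b + (g i - f i)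
  ∑-update f g i same = begin
    sum g                            ≡⟨ add-sub-cancel (sum g) (sum f) ⟩
    sum f + (sum g - sum f)          ≡⟨ cong (_+_ (sum f)) (∑-sub g f) ⟨
    sum f + ∑[ b < _ ] (g b - f b)   ≡⟨ cong (_+_ (sum f)) (∑-single (λ b → g b - f b) i vanish) ⟩
    sum f + (g i - f i)              ∎
    where
    open ≡-Reasoning
    vanish : ∀ b → b ≢ i → g b - f b ≡ 0ℤ
    vanish b b≢i = trans (cong (_- f b) (same b b≢i)) (ℤP.+-inverseʳ (f b))

  ∑-update₂ : ∀ {m} (f g : Fin m → ℤ) {i j} → i ≢ j → (∀ b → b ≢ i → b ≢ j → g b ≡ f b) →
              ∑[ b < m ] g b ≡ ∑[ b < m ] f b + ((g i - f i) + (g j - f j))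
  ∑-update₂ f g {i} {j} i≢j same = begin
    sum g                                  ≡⟨ add-sub-cancel (sum g) (sum f) ⟩
    sum f + (sum g - sum f)                ≡⟨ cong (_+_ (sum f)) (∑-sub g f) ⟨
    sum f + ∑[ b < _ ] (g b - f b)         ≡⟨ cong (_+_ (sum f)) (∑-pair (λ b → g b - f b) i≢j vanish) ⟩
    sum f + ((g i - f i) + (g j - f j))    ∎
    where
    open ≡-Reasoning
    vanish : ∀ b → b ≢ i → b ≢ j → g b - f b ≡ 0ℤ
    vanish b b≢i b≢j = trans (cong (_- f b) (same b b≢i b≢j)) (ℤP.+-inverseʳ (f b))

module PhaseAnalysis where

  open FinSumℤ
  open import Data.Bool using (Bool; true; false; if_then_else_; _∧_; _∨_; not)
  open import Data.Nat as ℕ using (ℕ; zero; suc; _∸_; _⊔_; z≤n; s≤s)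
  import Data.Nat.Properties as ℕP
  import Data.Nat.ListAction as ℕList
  open import Data.Integer as ℤ using (ℤ; +_; _+_; _-_; -_; _*_; 0ℤ)
  import Data.Integer.Properties as ℤP
  open import Data.Integer.Tactic.RingSolver using (solve-∀)
  import Data.Nat.Tactic.RingSolver as ℕSolver
  open import Data.Fin using (Fin; zero; suc; toℕ; _≟_)
  import Data.Fin.Properties as FinP
  open import Data.List using ([]; _∷_; foldr; map; tabulate; allFin)
  open import Data.List.Properties using (map-tabulate)
  open import Data.List.Membership.Propositional using (_∈_)
  open import Data.List.Membership.Propositional.Properties using (∈-allFin)
  open import Data.List.Relation.Unary.Any using (here; there)
  open import Data.Product using (∃; _×_; _,_; proj₁; proj₂)
  open import Data.Sum using (_⊎_; inj₁; inj₂)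
  open import Function using (_∘_)
  open import Data.Bool.Properties using (if-eta; if-idem-then)
  open import Relation.Nullary using (¬_; Dec; yes; no; does; contradiction)
  open import Relation.Nullary.Decidable using (_×-dec_)
  open import Data.Empty using (⊥)
  open import Relation.Unary using (Decidable)
  open import Relation.Binary.PropositionalEquality
  open import Algebra.Properties.Semiring.Sum ℤP.+-*-semiring
    using (sum; sum-syntax; sum-cong-≗; sum-replicate-zero; ∑-distrib-+; *-distribˡ-sum)

  ==-refl : ∀ {m} (a : Fin m) → (a == a) ≡ true
  ==-refl a with a ≟ a
  ... | yes _   = refl
  ... | no a≢a = contradiction refl a≢a

  ==-≢ : ∀ {m} {a b : Fin m} → a ≢ b → (a == b) ≡ false
  ==-≢ {a = a} {b} a≢b with a ≟ b
  ... | yes a≡b = contradiction a≡b a≢b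
  ... | no _    = refl

  listSum-allFin : ∀ {m} (F : Fin m → ℕ) → + ℕList.sum (map F (allFin m)) ≡ ∑[ a < m ] (+ F a)
  listSum-allFin F = trans (cong (+_ ∘ ℕList.sum) (map-tabulate (λ a → a) F)) (go F)
    where
    go : ∀ {m} (F : Fin m → ℕ) → + ℕList.sum (tabulate F) ≡ ∑[ a < m ] (+ F a)
    go {zero}  F = refl
    go {suc m} F = trans (ℤP.pos-+ (F zero) _) (cong (_+_ (+ F zero)) (go (F ∘ suc)))

  foldr-inflationary : ∀ {A : Set} (f : A → ℕ → ℕ) → (∀ y z → z ℕ.≤ f y z) →
                       ∀ z ys → z ℕ.≤ foldr f z ys
  foldr-inflationary f infl z []       = ℕP.≤-refl
  foldr-inflationary f infl z (y ∷ ys) = ℕP.≤-trans (foldr-inflationary f infl z ys) (infl y _)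

  foldr-upper : ∀ {A : Set} (f : A → ℕ → ℕ) → (∀ y z → z ℕ.≤ f y z) →
                ∀ {v y} → (∀ z → v ℕ.≤ f y z) → ∀ z {ys} → y ∈ ys → v ℕ.≤ foldr f z ys
  foldr-upper f infl v≤fy z (here refl) = v≤fy _
  foldr-upper f infl v≤fy z {y′ ∷ ys} (there y∈ys) =
    ℕP.≤-trans (foldr-upper f infl v≤fy z y∈ys) (infl y′ _)

  ∸-sub-∸ : ∀ a b → + (a ∸ b) - + (b ∸ a) ≡ + a - + b
  ∸-sub-∸ zero    zero    = refl
  ∸-sub-∸ zero    (suc b) = refl
  ∸-sub-∸ (suc a) zero    = refl
  ∸-sub-∸ (suc a) (suc b) = begin
    + (a ∸ b) - + (b ∸ a)  ≡⟨ ∸-sub-∸ a b ⟩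
    + a - + b              ≡⟨ ℤP.m-n≡m⊖n a b ⟩
    a ℤ.⊖ b                ≡⟨ ℤP.[1+m]⊖[1+n]≡m⊖n a b ⟨
    suc a ℤ.⊖ suc b        ≡⟨ ℤP.m-n≡m⊖n (suc a) (suc b) ⟨
    + suc a - + suc b      ∎
    where open ≡-Reasoning

  [p∸δ]-[q+[δ∸p]]-[p-q]≡-δ : ∀ p q δ → (+ (p ∸ δ) - (+ q + + (δ ∸ p))) - (+ p - + q) ≡ - + δ
  [p∸δ]-[q+[δ∸p]]-[p-q]≡-δ p q δ = begin
    (+ (p ∸ δ) - (+ q + + (δ ∸ p))) - (+ p - + q)  ≡⟨ rearrange (+ (p ∸ δ)) (+ q) (+ (δ ∸ p)) (+ p) ⟩
    (+ (p ∸ δ) - + (δ ∸ p)) - + p                  ≡⟨ cong (_- + p) (∸-sub-∸ p δ) ⟩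
    (+ p - + δ) - + p                              ≡⟨ cancel (+ p) (+ δ) ⟩
    - + δ                                          ∎
    where
    open ≡-Reasoning
    rearrange : ∀ a b c d → (a - (b + c)) - (d - b) ≡ (a - c) - d
    rearrange = solve-∀
    cancel : ∀ a b → (a - b) - a ≡ - b
    cancel = solve-∀

  pushed<2n²Δ : ∀ {a D L m} → 1 ℕ.≤ D → 1 ℕ.≤ m → + a ℤ.≤ + D * L →
                L + + (m ℕ.+ m) ℤ.≤ + m * + (m ℕ.+ m) → a ℕ.< 2 ℕ.* m ℕ.^ 2 ℕ.* D
  pushed<2n²Δ {a} {D} {L} {m} D≥1 m≥1 a≤DL L-bound = begin-strict
    a                                <⟨ ℕP.m<m+n a (ℕP.*-mono-≤ D≥1 (ℕP.≤-trans m≥1 (ℕP.m≤m+n m m))) ⟩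
    a ℕ.+ D ℕ.* (m ℕ.+ m)            ≤⟨ ℤP.drop‿+≤+ in-ℤ ⟩
    D ℕ.* (m ℕ.* (m ℕ.+ m))          ≡⟨ rearrange D m ⟩
    2 ℕ.* m ℕ.^ 2 ℕ.* D              ∎
    where
    open ℕP.≤-Reasoning
    rearrange : ∀ D m → D ℕ.* (m ℕ.* (m ℕ.+ m)) ≡ 2 ℕ.* (m ℕ.* (m ℕ.* 1)) ℕ.* D
    rearrange = ℕSolver.solve-∀
    in-ℤ : + a + + (D ℕ.* (m ℕ.+ m)) ℤ.≤ + (D ℕ.* (m ℕ.* (m ℕ.+ m)))
    in-ℤ = ℤR.begin
      + a + + (D ℕ.* (m ℕ.+ m))         ℤR.≡⟨ cong (_+_ (+ a)) (ℤP.pos-* D (m ℕ.+ m)) ⟩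
      + a + + D * + (m ℕ.+ m)           ℤR.≤⟨ ℤP.+-monoˡ-≤ (+ D * + (m ℕ.+ m)) a≤DL ⟩
      + D * L + + D * + (m ℕ.+ m)       ℤR.≡⟨ ℤP.*-distribˡ-+ (+ D) L (+ (m ℕ.+ m)) ⟨
      + D * (L + + (m ℕ.+ m))           ℤR.≤⟨ ℤP.*-monoˡ-≤-nonNeg (+ D) L-bound ⟩
      + D * (+ m * + (m ℕ.+ m))         ℤR.≡⟨ trans (ℤP.pos-* D _) (cong (_*_ (+ D)) (ℤP.pos-* m (m ℕ.+ m))) ⟨
      + (D ℕ.* (m ℕ.* (m ℕ.+ m)))       ℤR.∎
      where module ℤR = ℤP.≤-Reasoning

  Flow : ℕ → Set
  Flow n = Fin n → Fin n → ℕ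

  Labels : ℕ → Set
  Labels n = Fin n → ℕ

  module Phase {n : ℕ} (N : Network n) (k : ℕ) where
    open Network N
    open LMES N k

    n≥1 : 1 ℕ.≤ n
    n≥1 = ℕP.≤-<-trans z≤n (FinP.toℕ<n s)

    cap≤U : ∀ i j → cap i j ℕ.≤ U
    cap≤U i j = foldr-upper row row-infl cap≤row 0 (∈-allFin i)
      where
      row : Fin n → ℕ → ℕ
      row i z = foldr (λ j z′ → cap i j ⊔ z′) z (allFin n)
      row-infl : ∀ i z → z ℕ.≤ row i z
      row-infl i z = foldr-inflationary _ (λ j z → ℕP.m≤n⊔m (cap i j) z) z (allFin n)
      cap≤row : ∀ z → cap i j ℕ.≤ row i z
      cap≤row z = foldr-upper _ (λ j z → ℕP.m≤n⊔m (cap i j) z) (λ z → ℕP.m≤m⊔n (cap i j) z) z (∈-allFin j)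

    arc-sym-false : ∀ a b → arc a b ≡ false → arc b a ≡ false
    arc-sym-false a b ab with arc b a in ba
    ... | false = refl
    ... | true  = trans (sym (arc-sym b a ba)) ab

    arcFlow : Flow n → Fin n → Fin n → ℕ
    arcFlow x a b = if arc a b then x a b else 0

    netInflow : Flow n → Fin n → Fin n → ℤ
    netInflow x a b = + arcFlow x b a - + arcFlow x a b

    netInflow-antisym : ∀ x a b → netInflow x a b ≡ - netInflow x b a
    netInflow-antisym x a b = flip (+ arcFlow x b a) (+ arcFlow x a b)
      where
      flip : ∀ p q → p - q ≡ - (q - p)
      flip = solve-∀

    excess≡∑netInflow : ∀ x a → excess x a ≡ ∑[ b < n ] netInflow x a b
    excess≡∑netInflow x a = begin
      + inflow x a - + outflow x a
        ≡⟨ cong₂ _-_ (listSum-allFin (λ b → arcFlow x b a)) (listSum-allFin (arcFlow x a)) ⟩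
      ∑[ b < n ] (+ arcFlow x b a) - ∑[ b < n ] (+ arcFlow x a b)
        ≡⟨ ∑-sub (λ b → + arcFlow x b a) (λ b → + arcFlow x a b) ⟨
      ∑[ b < n ] netInflow x a b ∎
      where open ≡-Reasoning

    saturated⇒netInflow≤0 : ∀ x a b → (arc a b ≡ true → res x a b ≡ 0) → netInflow x a b ℤ.≤ 0ℤ
    saturated⇒netInflow≤0 x a b saturated with arc a b in ab
    ... | true rewrite arc-sym a b ab = ℤP.i≤j⇒i-j≤0 (ℤ.+≤+ (begin
          x b a          ≤⟨ ℕP.m≤n+m (x b a) (u a b) ⟩
          u a b ℕ.+ x b a  ≤⟨ ℕP.m∸n≡0⇒m≤n (saturated refl) ⟩
          x a b          ∎))
      where open ℕP.≤-Reasoning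
    ... | false rewrite arc-sym-false a b ab = ℤP.≤-refl

    closedSet-∑excess≤0 : ∀ {p} {P : Fin n → Set p} (P? : Decidable P) x →
                          (∀ a b → P a → ¬ P b → arc a b ≡ true → res x a b ≡ 0) →
                          ∑[ a < n ] (if does (P? a) then excess x a else 0ℤ) ℤ.≤ 0ℤ
    closedSet-∑excess≤0 {P = P} P? x closed = begin
      ∑[ a < n ] (if does (P? a) then excess x a else 0ℤ)
        ≡⟨ sum-cong-≗ (λ a → trans (cong (λ e → if does (P? a) then e else 0ℤ) (excess≡∑netInflow x a))
                                   (∑-if (does (P? a)) (netInflow x a))) ⟩
      ∑[ a < n ] ∑[ b < n ] (if does (P? a) then netInflow x a b else 0ℤ)
        ≡⟨ sum-cong-≗ (λ a → trans (sum-cong-≗ (split a)) (∑-distrib-+ (inside a) (leaving a))) ⟩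
      ∑[ a < n ] (∑[ b < n ] inside a b + ∑[ b < n ] leaving a b)
        ≡⟨ ∑-distrib-+ (λ a → sum (inside a)) (λ a → sum (leaving a)) ⟩
      ∑[ a < n ] ∑[ b < n ] inside a b + ∑[ a < n ] ∑[ b < n ] leaving a b
        ≡⟨ cong (_+ ∑[ a < n ] ∑[ b < n ] leaving a b) (∑-antisym≡0 inside inside-antisym) ⟩
      0ℤ + ∑[ a < n ] ∑[ b < n ] leaving a b
        ≤⟨ ℤP.+-monoʳ-≤ 0ℤ (∑-nonPos (λ a → ∑-nonPos (leaving≤0 a))) ⟩
      0ℤ ∎
      where
      open ℤP.≤-Reasoning
      inside leaving : Fin n → Fin n → ℤ
      inside  a b = if does (P? a) ∧ does (P? b) then netInflow x a b else 0ℤ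
      leaving a b = if does (P? a) ∧ not (does (P? b)) then netInflow x a b else 0ℤ
      split : ∀ a b → (if does (P? a) then netInflow x a b else 0ℤ) ≡ inside a b + leaving a b
      split a b with P? a | P? b
      ... | yes _ | yes _ = sym (ℤP.+-identityʳ _)
      ... | yes _ | no _  = sym (ℤP.+-identityˡ _)
      ... | no _  | _     = refl
      inside-antisym : ∀ a b → inside a b ≡ - inside b a
      inside-antisym a b with P? a | P? b
      ... | yes _ | yes _ = netInflow-antisym x a b
      ... | yes _ | no _  = refl
      ... | no _  | yes _ = refl
      ... | no _  | no _  = refl
      leaving≤0 : ∀ a b → leaving a b ℤ.≤ 0ℤ
      leaving≤0 a b with P? a | P? b
      ... | yes Pa | no ¬Pb = saturated⇒netInflow≤0 x a b (closed a b Pa ¬Pb)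
      ... | yes _  | yes _  = ℤP.≤-refl
      ... | no _   | _      = ℤP.≤-refl

    closedSet-excess≤0 : ∀ {p} {P : Fin n → Set p} (P? : Decidable P) x →
                         (∀ a b → P a → ¬ P b → arc a b ≡ true → res x a b ≡ 0) →
                         (∀ a → P a → 0ℤ ℤ.≤ excess x a) → ∀ i → P i → excess x i ℤ.≤ 0ℤ
    closedSet-excess≤0 {P = P} P? x closed nonNeg i Pi =
      ℤP.≤-trans (subst (ℤ._≤ _) restricted-i (term≤∑ restricted≥0 i)) (closedSet-∑excess≤0 P? x closed)
      where
      restricted≥0 : ∀ a → 0ℤ ℤ.≤ (if does (P? a) then excess x a else 0ℤ)
      restricted≥0 a with P? a
      ... | yes Pa = nonNeg a Pa
      ... | no _   = ℤP.≤-refl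
      restricted-i : (if does (P? i) then excess x i else 0ℤ) ≡ excess x i
      restricted-i with P? i
      ... | yes _   = refl
      ... | no ¬Pi = contradiction Pi ¬Pi

    Valid : Flow n → Labels n → Set
    Valid x d = ∀ a b → arc a b ≡ true → 0 ℕ.< res x a b → d a ℕ.≤ suc (d b)

    Preflow : Flow n → Set
    Preflow x = ∀ a → a ≢ s → 0ℤ ℤ.≤ excess x a

    module _ {x : Flow n} {d : Labels n} (valid : Valid x d) (preflow : Preflow x) (d-s : d s ≡ n)
             {i : Fin n} (active : 0ℤ ℤ.< excess x i) where

      levels-occupied : ∀ g → n ℕ.≤ g → g ℕ.≤ d i → ∃ λ a → d a ≡ g
      levels-occupied g n≤g g≤di with FinP.any? (λ a → d a ℕ.≟ g)
      ... | yes occupied = occupied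
      ... | no empty     = contradiction active (ℤP.≤⇒≯ excess-i≤0)
        where
        n<g : n ℕ.< g
        n<g = ℕP.≤∧≢⇒< n≤g (λ n≡g → empty (s , trans d-s n≡g))
        g<di : g ℕ.< d i
        g<di = ℕP.≤∧≢⇒< g≤di (λ g≡di → empty (i , sym g≡di))
        closed : ∀ a b → g ℕ.< d a → ¬ g ℕ.< d b → arc a b ≡ true → res x a b ≡ 0
        closed a b g<da g≮db ab with res x a b in r
        ... | zero  = refl
        ... | suc _ = contradiction (valid a b ab (subst (0 ℕ.<_) (sym r) (s≤s z≤n)))
                        (ℕP.<⇒≱ (ℕP.≤-<-trans db<g g<da))
          where
          db<g : suc (d b) ℕ.≤ g
          db<g = ℕP.≤∧≢⇒< (ℕP.≮⇒≥ g≮db) (λ db≡g → empty (b , db≡g))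
        excess-i≤0 : excess x i ℤ.≤ 0ℤ
        excess-i≤0 = closedSet-excess≤0 (λ a → g ℕ.<? d a) x closed
                       (λ a g<da → preflow a (λ { refl → ℕP.<-asym n<g (subst (g ℕ.<_) d-s g<da) })) i g<di

      -- levels n, n+1, …, 2n would hold n + 1 distinct nodes
      active-label<2n : d i ℕ.< n ℕ.+ n
      active-label<2n = ℕP.≰⇒> λ 2n≤di → pigeon (node 2n≤di) (node-level 2n≤di)
        where
        level≤di : n ℕ.+ n ℕ.≤ d i → ∀ (c : Fin (suc n)) → n ℕ.+ toℕ c ℕ.≤ d i
        level≤di 2n≤di c = ℕP.≤-trans (ℕP.+-monoʳ-≤ n (FinP.toℕ≤pred[n] c)) 2n≤di
        node : n ℕ.+ n ℕ.≤ d i → Fin (suc n) → Fin n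
        node 2n≤di c = proj₁ (levels-occupied (n ℕ.+ toℕ c) (ℕP.m≤m+n n _) (level≤di 2n≤di c))
        node-level : ∀ 2n≤di c → d (node 2n≤di c) ≡ n ℕ.+ toℕ c
        node-level 2n≤di c = proj₂ (levels-occupied (n ℕ.+ toℕ c) (ℕP.m≤m+n n _) (level≤di 2n≤di c))
        pigeon : (f : Fin (suc n) → Fin n) → (∀ c → d (f c) ≡ n ℕ.+ toℕ c) → ⊥
        pigeon f level with FinP.pigeonhole (ℕP.n<1+n n) f
        ... | c₁ , c₂ , c₁<c₂ , f-eq =
          ℕP.<-irrefl (ℕP.+-cancelˡ-≡ n _ _ (trans (sym (level c₁)) (trans (cong d f-eq) (level c₂)))) c₁<c₂

    module _ (x : Flow n) {i j : Fin n} (δ : ℕ) where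

      send-other : ∀ {a b} → ¬ (a ≡ j × b ≡ i) → ¬ (a ≡ i × b ≡ j) → send x i j δ a b ≡ x a b
      send-other {a} {b} not-ji not-ij with a ≟ j | b ≟ i | a ≟ i | b ≟ j
      ... | yes a≡j | yes b≡i | _       | _       = contradiction (a≡j , b≡i) not-ji
      ... | yes _   | no _    | yes a≡i | yes b≡j = contradiction (a≡i , b≡j) not-ij
      ... | yes _   | no _    | yes _   | no _    = refl
      ... | yes _   | no _    | no _    | _       = refl
      ... | no _    | _       | yes a≡i | yes b≡j = contradiction (a≡i , b≡j) not-ij
      ... | no _    | _       | yes _   | no _    = refl
      ... | no _    | _       | no _    | _       = refl

      res-send-other : ∀ {a b} → ¬ (a ≡ i × b ≡ j) → ¬ (a ≡ j × b ≡ i) →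
                       res (send x i j δ) a b ≡ res x a b
      res-send-other not-ij not-ji
        rewrite send-other not-ji not-ij
              | send-other (λ { (b≡j , a≡i) → not-ij (a≡i , b≡j) })
                           (λ { (b≡i , a≡j) → not-ji (a≡j , b≡i) }) = refl

      netInflow-send-source : i ≢ j → arc i j ≡ true → netInflow (send x i j δ) i j - netInflow x i j ≡ - + δ
      netInflow-send-source i≢j ij rewrite ij | arc-sym i j ij | ==-refl j | ==-refl i | ==-≢ i≢j =
        [p∸δ]-[q+[δ∸p]]-[p-q]≡-δ (x j i) (x i j) δ

      excess-send-other : ∀ {a} → a ≢ i → a ≢ j → excess (send x i j δ) a ≡ excess x a
      excess-send-other {a} a≢i a≢j = begin
        excess (send x i j δ) a           ≡⟨ excess≡∑netInflow (send x i j δ) a ⟩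
        ∑[ b < n ] netInflow (send x i j δ) a b ≡⟨ sum-cong-≗ unchanged ⟩
        ∑[ b < n ] netInflow x a b        ≡⟨ excess≡∑netInflow x a ⟨
        excess x a                        ∎
        where
        open ≡-Reasoning
        unchanged : ∀ b → netInflow (send x i j δ) a b ≡ netInflow x a b
        unchanged b rewrite send-other {b} {a} (a≢i ∘ proj₂) (a≢j ∘ proj₂)
                          | send-other {a} {b} (a≢j ∘ proj₁) (a≢i ∘ proj₁) = refl

      excess-send-source : i ≢ j → arc i j ≡ true → excess (send x i j δ) i ≡ excess x i - + δ
      excess-send-source i≢j ij = begin
        excess (send x i j δ) i                      ≡⟨ excess≡∑netInflow (send x i j δ) i ⟩
        ∑[ b < n ] netInflow (send x i j δ) i b      ≡⟨ ∑-update (netInflow x i) (netInflow (send x i j δ) i) j unchanged ⟩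
        ∑[ b < n ] netInflow x i b + (netInflow (send x i j δ) i j - netInflow x i j)
                                                     ≡⟨ cong₂ _+_ (excess≡∑netInflow x i) (sym (netInflow-send-source i≢j ij)) ⟨
        excess x i - + δ                             ∎
        where
        open ≡-Reasoning
        unchanged : ∀ b → b ≢ j → netInflow (send x i j δ) i b ≡ netInflow x i b
        unchanged b b≢j rewrite send-other {b} {i} (b≢j ∘ proj₁) (i≢j ∘ proj₂)
                              | send-other {i} {b} (i≢j ∘ proj₁) (b≢j ∘ proj₂) = refl

      excess-send-target : i ≢ j → arc i j ≡ true → excess (send x i j δ) j ≡ excess x j + + δ
      excess-send-target i≢j ij = begin
        excess (send x i j δ) j                      ≡⟨ excess≡∑netInflow (send x i j δ) j ⟩
        ∑[ b < n ] netInflow (send x i j δ) j b      ≡⟨ ∑-update (netInflow x j) (netInflow (send x i j δ) j) i unchanged ⟩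
        ∑[ b < n ] netInflow x j b + (netInflow (send x i j δ) j i - netInflow x j i)
                                                     ≡⟨ cong₂ _+_ (excess≡∑netInflow x j) (sym reversed) ⟨
        excess x j + + δ                             ∎
        where
        open ≡-Reasoning
        j≢i : j ≢ i
        j≢i = i≢j ∘ sym
        unchanged : ∀ b → b ≢ i → netInflow (send x i j δ) j b ≡ netInflow x j b
        unchanged b b≢i rewrite send-other {b} {j} (j≢i ∘ proj₂) (b≢i ∘ proj₁)
                              | send-other {j} {b} (b≢i ∘ proj₂) (j≢i ∘ proj₁) = refl
        negate : ∀ a a′ → a′ - a ≡ - + δ → - a′ - - a ≡ + δ
        negate a a′ diff = trans (neg-sub a a′) (trans (cong -_ diff) (ℤP.neg-involutive (+ δ)))
          where
          neg-sub : ∀ a a′ → - a′ - - a ≡ - (a′ - a)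
          neg-sub = solve-∀
        reversed : netInflow (send x i j δ) j i - netInflow x j i ≡ + δ
        reversed rewrite netInflow-antisym (send x i j δ) j i | netInflow-antisym x j i =
          negate (netInflow x i j) (netInflow (send x i j δ) i j) (netInflow-send-source i≢j ij)

      valid-send : ∀ {d} → Valid x d → d i ≡ suc (d j) → Valid (send x i j δ) d
      valid-send {d} valid dᵢ≡1+dⱼ a b ab r with (a ≟ i) ×-dec (b ≟ j) | (a ≟ j) ×-dec (b ≟ i)
      ... | yes (refl , refl) | _                 = ℕP.≤-reflexive dᵢ≡1+dⱼ
      ... | no _              | yes (refl , refl) =
        ℕP.m≤n⇒m≤1+n (subst (d j ℕ.≤_) (sym dᵢ≡1+dⱼ) (ℕP.n≤1+n (d j)))
      ... | no ¬ij            | no ¬ji            = valid a b ab (subst (0 ℕ.<_) (res-send-other ¬ij ¬ji) r)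

    isTerminal : Fin n → Bool
    isTerminal a = (a == s) ∨ (a == t)

    internalLabel : Labels n → Fin n → ℕ
    internalLabel d a = if isTerminal a then 0 else d a

    potential : Flow n → Labels n → ℤ
    potential x d = ∑[ a < n ] (excess x a * + internalLabel d a)

    labelSum : Labels n → ℤ
    labelSum d = ∑[ a < n ] (+ internalLabel d a)

    internalLabel-internal : ∀ d {a} → a ≢ s → a ≢ t → internalLabel d a ≡ d a
    internalLabel-internal d a≢s a≢t rewrite ==-≢ a≢s | ==-≢ a≢t = refl

    internalLabel-s : ∀ d → internalLabel d s ≡ 0
    internalLabel-s d rewrite ==-refl s = refl

    internalLabel-t : ∀ d → internalLabel d t ≡ 0
    internalLabel-t d rewrite ==-≢ (s≢t ∘ sym) | ==-refl t = refl

    internalLabel-view : ∀ d a → internalLabel d a ≡ 0 ⊎ (a ≢ s × a ≢ t × internalLabel d a ≡ d a)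
    internalLabel-view d a = view (a ≟ s) (a ≟ t)
      where
      view : Dec (a ≡ s) → Dec (a ≡ t) → internalLabel d a ≡ 0 ⊎ (a ≢ s × a ≢ t × internalLabel d a ≡ d a)
      view (yes refl) _          = inj₁ (internalLabel-s d)
      view (no _)     (yes refl) = inj₁ (internalLabel-t d)
      view (no a≢s)   (no a≢t)   = inj₂ (a≢s , a≢t , internalLabel-internal d a≢s a≢t)

    internalLabel≤label : ∀ d a → internalLabel d a ℕ.≤ d a
    internalLabel≤label d a with internalLabel-view d a
    ... | inj₁ zero-label          = subst (ℕ._≤ d a) (sym zero-label) z≤n
    ... | inj₂ (_ , _ , same-label) = ℕP.≤-reflexive same-label

    potential-transfer : ∀ x x′ d {i j} δ → i ≢ j →
                         excess x′ i ≡ excess x i - + δ → excess x′ j ≡ excess x j + + δ →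
                         (∀ a → a ≢ i → a ≢ j → excess x′ a ≡ excess x a) →
                         potential x′ d ≡ potential x d + + δ * (+ internalLabel d j - + internalLabel d i)
    potential-transfer x x′ d {i} {j} δ i≢j source target others = begin
      potential x′ d
        ≡⟨ ∑-update₂ (weighted x) (weighted x′) i≢j
                     (λ a a≢i a≢j → cong (_* + internalLabel d a) (others a a≢i a≢j)) ⟩
      potential x d + ((excess x′ i * hᵢ - eᵢ * hᵢ) + (excess x′ j * hⱼ - eⱼ * hⱼ))
        ≡⟨ cong₂ (λ e′ᵢ e′ⱼ → potential x d + ((e′ᵢ * hᵢ - eᵢ * hᵢ) + (e′ⱼ * hⱼ - eⱼ * hⱼ))) source target ⟩
      potential x d + (((eᵢ - + δ) * hᵢ - eᵢ * hᵢ) + ((eⱼ + + δ) * hⱼ - eⱼ * hⱼ))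
        ≡⟨ simplify (potential x d) eᵢ eⱼ (+ δ) hᵢ hⱼ ⟩
      potential x d + + δ * (hⱼ - hᵢ) ∎
      where
      open ≡-Reasoning
      weighted : Flow n → Fin n → ℤ
      weighted y a = excess y a * + internalLabel d a
      eᵢ eⱼ hᵢ hⱼ : ℤ
      eᵢ = excess x i
      eⱼ = excess x j
      hᵢ = + internalLabel d i
      hⱼ = + internalLabel d j
      simplify : ∀ P eᵢ eⱼ δ hᵢ hⱼ →
                 P + (((eᵢ - δ) * hᵢ - eᵢ * hᵢ) + ((eⱼ + δ) * hⱼ - eⱼ * hⱼ)) ≡ P + δ * (hⱼ - hᵢ)
      simplify = solve-∀

    relabelAt-self : ∀ (d : Labels n) i → relabelAt d i i ≡ suc (d i)
    relabelAt-self d i rewrite ==-refl i = refl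

    relabelAt-other : ∀ (d : Labels n) {i a} → a ≢ i → relabelAt d i a ≡ d a
    relabelAt-other d a≢i rewrite ==-≢ a≢i = refl

    label≤relabelAt : ∀ (d : Labels n) i a → d a ℕ.≤ relabelAt d i a
    label≤relabelAt d i a with a ≟ i
    ... | yes refl = ℕP.n≤1+n (d a)
    ... | no _     = ℕP.≤-refl

    valid-relabel : ∀ {x d i} → Valid x d → (∀ b → arc i b ≡ true → 0 ℕ.< res x i b → d i ≢ suc (d b)) →
                    Valid x (relabelAt d i)
    valid-relabel {x} {d} {i} valid inadmissible a b ab r =
      ℕP.≤-trans (from-a (a ≟ i)) (s≤s (label≤relabelAt d i b))
      where
      from-a : Dec (a ≡ i) → relabelAt d i a ℕ.≤ suc (d b)
      from-a (yes refl) = subst (ℕ._≤ suc (d b)) (sym (relabelAt-self d a))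
                                (ℕP.≤∧≢⇒< (valid a b ab r) (inadmissible b ab r))
      from-a (no a≢i)   = subst (ℕ._≤ suc (d b)) (sym (relabelAt-other d a≢i)) (valid a b ab r)

    internalLabel-relabelAt-other : ∀ d {i a} → a ≢ i → internalLabel (relabelAt d i) a ≡ internalLabel d a
    internalLabel-relabelAt-other d {a = a} a≢i =
      cong (λ l → if isTerminal a then 0 else l) (relabelAt-other d a≢i)

    internalLabel-relabelAt-self : ∀ d {i} → i ≢ s → i ≢ t →
                                   internalLabel (relabelAt d i) i ≡ suc (internalLabel d i)
    internalLabel-relabelAt-self d {i} i≢s i≢t = begin
      internalLabel (relabelAt d i) i  ≡⟨ internalLabel-internal (relabelAt d i) i≢s i≢t ⟩
      relabelAt d i i                  ≡⟨ relabelAt-self d i ⟩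
      suc (d i)                        ≡⟨ cong suc (internalLabel-internal d i≢s i≢t) ⟨
      suc (internalLabel d i)          ∎
      where open ≡-Reasoning

    potential-relabel : ∀ x d {i} → i ≢ s → i ≢ t → potential x (relabelAt d i) ≡ potential x d + excess x i
    potential-relabel x d {i} i≢s i≢t = begin
      potential x (relabelAt d i)
        ≡⟨ ∑-update (λ a → excess x a * + internalLabel d a) (λ a → excess x a * + internalLabel (relabelAt d i) a) i
                    (λ a a≢i → cong (λ l → excess x a * + l) (internalLabel-relabelAt-other d a≢i)) ⟩
      potential x d + (excess x i * + internalLabel (relabelAt d i) i - excess x i * + internalLabel d i)
        ≡⟨ cong (λ l → potential x d + (excess x i * + l - excess x i * + internalLabel d i))
                (internalLabel-relabelAt-self d i≢s i≢t) ⟩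
      potential x d + (excess x i * (+ 1 + + internalLabel d i) - excess x i * + internalLabel d i)
        ≡⟨ simplify (potential x d) (excess x i) (+ internalLabel d i) ⟩
      potential x d + excess x i ∎
      where
      open ≡-Reasoning
      simplify : ∀ P e h → P + (e * (+ 1 + h) - e * h) ≡ P + e
      simplify = solve-∀

    labelSum-relabel : ∀ d {i} → i ≢ s → i ≢ t → labelSum (relabelAt d i) ≡ labelSum d + + 1
    labelSum-relabel d {i} i≢s i≢t = begin
      labelSum (relabelAt d i)
        ≡⟨ ∑-update (λ a → + internalLabel d a) (λ a → + internalLabel (relabelAt d i) a) i
                    (λ a a≢i → cong +_ (internalLabel-relabelAt-other d a≢i)) ⟩
      labelSum d + (+ internalLabel (relabelAt d i) i - + internalLabel d i)
        ≡⟨ cong (λ l → labelSum d + (+ l - + internalLabel d i)) (internalLabel-relabelAt-self d i≢s i≢t) ⟩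
      labelSum d + ((+ 1 + + internalLabel d i) - + internalLabel d i)
        ≡⟨ simplify (labelSum d) (+ internalLabel d i) ⟩
      labelSum d + + 1 ∎
      where
      open ≡-Reasoning
      simplify : ∀ L h → L + ((+ 1 + h) - h) ≡ L + + 1
      simplify = solve-∀

    1≤c*e⇒0<e : ∀ c e → + 1 ℤ.≤ + c * e → 0ℤ ℤ.< e
    1≤c*e⇒0<e c e 1≤ce = ℤP.≰⇒> λ e≤0 →
      contradiction (ℤP.≤-trans 1≤ce (ℤP.≤-trans (ℤP.*-monoˡ-≤-nonNeg (+ c) e≤0)
                                               (ℤP.≤-reflexive (ℤP.*-zeroʳ (+ c)))))
                    λ { (ℤ.+≤+ ()) }

    selected-internal : ∀ {σ i} → Selected σ i → i ≢ s × i ≢ t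
    selected-internal (inj₁ ((i≢s , i≢t , _) , _)) = i≢s , i≢t
    selected-internal (inj₂ ((i≢s , i≢t , _) , _)) = i≢s , i≢t

    selected-active : ∀ {σ i} → 1 ℕ.≤ Δ σ → Selected σ i → 0ℤ ℤ.< excess (x σ) i
    selected-active Δ≥1 (inj₁ ((_ , _ , large)  , _)) = 1≤c*e⇒0<e 2 _ (ℤP.≤-trans (ℤ.+≤+ Δ≥1) large)
    selected-active Δ≥1 (inj₂ ((_ , _ , medium , _) , _)) = 1≤c*e⇒0<e k _ (ℤP.≤-trans (ℤ.+≤+ Δ≥1) medium)

    admissible⇒≢ : ∀ {σ i j} → Admissible σ i j → i ≢ j
    admissible⇒≢ (_ , _ , dᵢ≡1+dⱼ) refl = ℕP.1+n≢n (sym dᵢ≡1+dⱼ)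

    pushAmount≤excess : ∀ σ i j → pushAmount σ i j ℤ.≤ excess (x σ) i
    pushAmount≤excess σ i j with isTerminal j
    ... | true  = ℤP.i⊓j≤i _ _
    ... | false = ℤP.≤-trans (ℤP.i⊓j≤i _ _) (ℤP.i⊓j≤i _ _)

    pushAmount≤room : ∀ σ i {j} → j ≢ s → j ≢ t → pushAmount σ i j ℤ.≤ + Δ σ - excess (x σ) j
    pushAmount≤room σ i j≢s j≢t rewrite ==-≢ j≢s | ==-≢ j≢t = ℤP.i⊓j≤j _ _

    record Invariant (σ : State n) : Set where
      field
        Δ≥1      : 1 ℕ.≤ Δ σ
        label-s  : d σ s ≡ n
        valid    : Valid (x σ) (d σ)
        label≤2n : ∀ a → d σ a ℕ.≤ n ℕ.+ n
        preflow  : Preflow (x σ)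
        excess≤Δ : ∀ a → a ≢ s → a ≢ t → excess (x σ) a ℤ.≤ + Δ σ
    open Invariant

    push-preserves : ∀ {σ i j δ} → Invariant σ → Selected σ i → Admissible σ i j → + δ ≡ pushAmount σ i j →
                     Invariant ⟨ send (x σ) i j δ , d σ , Δ σ ⟩
    push-preserves {σ} {i} {j} {δ} inv sel adm@(ij , _ , dᵢ≡1+dⱼ) δ≡ = record
      { Δ≥1     = Δ≥1 inv
      ; label-s  = label-s inv
      ; valid    = valid-send (x σ) δ (valid inv) dᵢ≡1+dⱼ
      ; label≤2n = label≤2n inv
      ; preflow  = λ a a≢s → preflow′ a a≢s (a ≟ i) (a ≟ j)
      ; excess≤Δ = λ a a≢s a≢t → excess≤Δ′ a a≢s a≢t (a ≟ i) (a ≟ j)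
      }
      where
      i≢j : i ≢ j
      i≢j = admissible⇒≢ {σ} adm
      i≢s = proj₁ (selected-internal sel)
      i≢t = proj₂ (selected-internal sel)
      x′ = send (x σ) i j δ
      e = excess (x σ)
      δ≤eᵢ : + δ ℤ.≤ e i
      δ≤eᵢ = subst (ℤ._≤ e i) (sym δ≡) (pushAmount≤excess σ i j)
      preflow′ : ∀ a → a ≢ s → Dec (a ≡ i) → Dec (a ≡ j) → 0ℤ ℤ.≤ excess x′ a
      preflow′ a _ (yes refl) _ =
        subst (0ℤ ℤ.≤_) (sym (excess-send-source (x σ) δ i≢j ij)) (ℤP.i≤j⇒0≤j-i δ≤eᵢ)
      preflow′ a a≢s (no _) (yes refl) =
        subst (0ℤ ℤ.≤_) (sym (excess-send-target (x σ) δ i≢j ij))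
              (ℤP.≤-trans (preflow inv a a≢s) (ℤP.i≤i+j (e a) (+ δ)))
      preflow′ a a≢s (no a≢i) (no a≢j) =
        subst (0ℤ ℤ.≤_) (sym (excess-send-other (x σ) δ a≢i a≢j)) (preflow inv a a≢s)
      excess≤Δ′ : ∀ a → a ≢ s → a ≢ t → Dec (a ≡ i) → Dec (a ≡ j) → excess x′ a ℤ.≤ + Δ σ
      excess≤Δ′ a _ _ (yes refl) _ =
        subst (ℤ._≤ + Δ σ) (sym (excess-send-source (x σ) δ i≢j ij))
              (ℤP.≤-trans (ℤP.i-j≤i (e i) (+ δ)) (excess≤Δ inv i i≢s i≢t))
      excess≤Δ′ a a≢s a≢t (no _) (yes refl) =
        subst (ℤ._≤ + Δ σ) (sym (excess-send-target (x σ) δ i≢j ij))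
              (ℤP.≤-trans (ℤP.+-monoʳ-≤ (e j) (subst (ℤ._≤ _) (sym δ≡) (pushAmount≤room σ i a≢s a≢t)))
                          (ℤP.≤-reflexive (fill (e j) (+ Δ σ))))
        where
        fill : ∀ eⱼ D → eⱼ + (D - eⱼ) ≡ D
        fill = solve-∀
      excess≤Δ′ a a≢s a≢t (no a≢i) (no a≢j) =
        subst (ℤ._≤ + Δ σ) (sym (excess-send-other (x σ) δ a≢i a≢j)) (excess≤Δ inv a a≢s a≢t)

    relabel-preserves : ∀ {σ i} → Invariant σ → Selected σ i → (∀ j → ¬ Admissible σ i j) →
                        Invariant ⟨ x σ , relabelAt (d σ) i , Δ σ ⟩
    relabel-preserves {σ} {i} inv sel inadmissible = record
      { Δ≥1     = Δ≥1 inv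
      ; label-s  = trans (relabelAt-other (d σ) (i≢s ∘ sym)) (label-s inv)
      ; valid    = valid-relabel {x σ} (valid inv) (λ b ib r dᵢ≡1+d_b → inadmissible b (ib , r , dᵢ≡1+d_b))
      ; label≤2n = λ a → label≤2n′ a (a ≟ i)
      ; preflow  = preflow inv
      ; excess≤Δ = excess≤Δ inv
      }
      where
      i≢s = proj₁ (selected-internal sel)
      d′ = relabelAt (d σ) i
      label≤2n′ : ∀ a → Dec (a ≡ i) → d′ a ℕ.≤ n ℕ.+ n
      label≤2n′ a (yes refl) = subst (ℕ._≤ n ℕ.+ n) (sym (relabelAt-self (d σ) a))
        (active-label<2n (valid inv) (preflow inv) (label-s inv) (selected-active (Δ≥1 inv) sel))
      label≤2n′ a (no a≢i)   = subst (ℕ._≤ n ℕ.+ n) (sym (relabelAt-other (d σ) a≢i)) (label≤2n inv a)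

    step-preserves : ∀ {σ σ′ a} → Invariant σ → Step σ σ′ a → Invariant σ′
    step-preserves inv (push σ i j δ sel adm δ≡)   = push-preserves inv sel adm δ≡
    step-preserves inv (relabel σ i sel inadmissible) = relabel-preserves inv sel inadmissible

    endPhase-preserves : ∀ {σ σ′} → Invariant σ → EndPhase σ σ′ → Invariant σ′
    endPhase-preserves inv (endPhase σ Δ′ no-large no-medium kΔ′≡Δ Δ′≥1) = record
      { Δ≥1     = Δ′≥1
      ; label-s  = label-s inv
      ; valid    = valid inv
      ; label≤2n = label≤2n inv
      ; preflow  = preflow inv
      ; excess≤Δ = excess≤Δ′
      }
      where
      excess≤Δ′ : ∀ a → a ≢ s → a ≢ t → excess (x σ) a ℤ.≤ + Δ′
      excess≤Δ′ a a≢s a≢t = ℤP.≮⇒≥ λ Δ′<e → no-medium a (a≢s , a≢t , Δ≤ke Δ′<e , 2e<Δ)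
        where
        2e<Δ : + 2 * excess (x σ) a ℤ.< + Δ σ
        2e<Δ = ℤP.≰⇒> λ Δ≤2e → no-large a (a≢s , a≢t , Δ≤2e)
        Δ≤ke : + Δ′ ℤ.< excess (x σ) a → + Δ σ ℤ.≤ + k * excess (x σ) a
        Δ≤ke Δ′<e = subst (ℤ._≤ + k * excess (x σ) a) (trans (sym (ℤP.pos-* k Δ′)) (cong +_ kΔ′≡Δ))
                          (ℤP.*-monoˡ-≤-nonNeg (+ k) (ℤP.<⇒≤ Δ′<e))

    excess-initial : ∀ {a} → a ≢ s → excess initialFlow a ≡ + cap s a
    excess-initial {a} a≢s = begin
      excess initialFlow a                ≡⟨ excess≡∑netInflow initialFlow a ⟩
      ∑[ b < n ] netInflow initialFlow a b ≡⟨ ∑-single (netInflow initialFlow a) s from-non-source ⟩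
      netInflow initialFlow a s           ≡⟨ from-source ⟩
      + cap s a                           ∎
      where
      open ≡-Reasoning
      from-non-source : ∀ b → b ≢ s → netInflow initialFlow a b ≡ 0ℤ
      from-non-source b b≢s rewrite ==-≢ b≢s | ==-≢ a≢s | if-eta (arc b a) {0} | if-eta (arc a b) {0} = refl
      from-source : netInflow initialFlow a s ≡ + cap s a
      from-source rewrite ==-refl s | ==-≢ a≢s | if-idem-then (arc s a) {u s a} {0} | if-eta (arc a s) {0} =
        ℤP.+-identityʳ (+ cap s a)

    res-initial-source : ∀ {b} → b ≢ s → arc s b ≡ true → res initialFlow s b ≡ 0
    res-initial-source {b} b≢s sb rewrite ==-refl s | ==-≢ b≢s | sb =
      trans (cong (_∸ u s b) (ℕP.+-identityʳ (u s b))) (ℕP.n∸n≡0 (u s b))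

    initialLabel-s : initialLabel s ≡ n
    initialLabel-s rewrite ==-refl s = refl

    initialLabel-other : ∀ {a} → a ≢ s → initialLabel a ≡ 0
    initialLabel-other a≢s rewrite ==-≢ a≢s = refl

    initial-invariant : ∀ {σ} → Initial σ → Invariant σ
    initial-invariant {⟨ .initialFlow , .initialLabel , Δ₀ ⟩} (refl , refl , (_ , _ , U<Δ₀ , _)) = record
      { Δ≥1     = ℕP.≤-trans (s≤s z≤n) U<Δ₀
      ; label-s  = initialLabel-s
      ; valid    = λ a b ab r → valid₀ a b ab r (a ≟ s) (b ≟ s)
      ; label≤2n = λ a → label≤2n₀ a (a ≟ s)
      ; preflow  = λ a a≢s → subst (0ℤ ℤ.≤_) (sym (excess-initial a≢s)) (ℤ.+≤+ z≤n)
      ; excess≤Δ = λ a a≢s _ → subst (ℤ._≤ + Δ₀) (sym (excess-initial a≢s))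
                                     (ℤ.+≤+ (ℕP.≤-trans (cap≤U s a) (ℕP.<⇒≤ U<Δ₀)))
      }
      where
      label≤2n₀ : ∀ a → Dec (a ≡ s) → initialLabel a ℕ.≤ n ℕ.+ n
      label≤2n₀ a (yes refl) = subst (ℕ._≤ n ℕ.+ n) (sym initialLabel-s) (ℕP.m≤m+n n n)
      label≤2n₀ a (no a≢s)   = subst (ℕ._≤ n ℕ.+ n) (sym (initialLabel-other a≢s)) z≤n
      valid₀ : ∀ a b → arc a b ≡ true → 0 ℕ.< res initialFlow a b → Dec (a ≡ s) → Dec (b ≡ s) →
               initialLabel a ℕ.≤ suc (initialLabel b)
      valid₀ a b _  _ (yes refl) (yes refl) = ℕP.n≤1+n (initialLabel a)
      valid₀ a b ab r (yes refl) (no b≢s)   = contradiction (subst (0 ℕ.<_) (res-initial-source b≢s ab) r) λ ()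
      valid₀ a b _  _ (no a≢s)   _          = subst (ℕ._≤ _) (sym (initialLabel-other a≢s)) z≤n

    reachable-invariant : ∀ {σ} → Reachable σ → Invariant σ
    reachable-invariant (init σ initial)    = initial-invariant initial
    reachable-invariant (step reachable st) = step-preserves (reachable-invariant reachable) st
    reachable-invariant (phase reachable e) = endPhase-preserves (reachable-invariant reachable) e

    phaseStart-invariant : ∀ {σ} → PhaseStart σ → Invariant σ
    phaseStart-invariant (first σ initial)  = initial-invariant initial
    phaseStart-invariant (next reachable e) = endPhase-preserves (reachable-invariant reachable) e

    Φ : State n → ℤ
    Φ σ = potential (x σ) (d σ)

    Λ : State n → ℤ
    Λ σ = labelSum (d σ)

    PotentialBound : ℕ → State n → State n → ℕ → Set
    PotentialBound D σ σ′ a = + a + Φ σ′ ℤ.≤ Φ σ + + D * (Λ σ′ - Λ σ)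

    push-bound : ∀ {σ i j δ} → Selected σ i → Admissible σ i j →
                 PotentialBound (Δ σ) σ ⟨ send (x σ) i j δ , d σ , Δ σ ⟩ δ
    push-bound {σ} {i} {j} {δ} sel adm@(ij , _ , dᵢ≡1+dⱼ) = begin
      + δ + potential (send (x σ) i j δ) (d σ)
        ≡⟨ cong (_+_ (+ δ)) (potential-transfer (x σ) (send (x σ) i j δ) (d σ) δ i≢j
             (excess-send-source (x σ) δ i≢j ij) (excess-send-target (x σ) δ i≢j ij)
             (λ _ → excess-send-other (x σ) δ)) ⟩
      + δ + (Φ σ + + δ * (hⱼ - + internalLabel (d σ) i))
        ≡⟨ cong (λ l → + δ + (Φ σ + + δ * (hⱼ - + l)))
                (trans (internalLabel-internal (d σ) i≢s i≢t) dᵢ≡1+dⱼ) ⟩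
      + δ + (Φ σ + + δ * (hⱼ - (+ 1 + + d σ j)))
        ≡⟨ regroup (Φ σ) (+ δ) hⱼ (+ d σ j) ⟩
      Φ σ + + δ * (hⱼ - + d σ j)
        ≤⟨ ℤP.+-monoʳ-≤ (Φ σ) (ℤP.*-monoˡ-≤-nonNeg (+ δ)
                                (ℤP.i≤j⇒i-j≤0 (ℤ.+≤+ (internalLabel≤label (d σ) j)))) ⟩
      Φ σ + + δ * 0ℤ
        ≡⟨ no-relabel (Φ σ) (+ δ) (+ Δ σ) (Λ σ) ⟩
      Φ σ + + Δ σ * (Λ σ - Λ σ) ∎
      where
      open ℤP.≤-Reasoning
      i≢j : i ≢ j
      i≢j = admissible⇒≢ {σ} adm
      i≢s = proj₁ (selected-internal sel)
      i≢t = proj₂ (selected-internal sel)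
      hⱼ = + internalLabel (d σ) j
      regroup : ∀ P δ h d → δ + (P + δ * (h - (+ 1 + d))) ≡ P + δ * (h - d)
      regroup = solve-∀
      no-relabel : ∀ P δ D L → P + δ * 0ℤ ≡ P + D * (L - L)
      no-relabel = solve-∀
    relabel-bound : ∀ {σ i} → Invariant σ → Selected σ i →
                    PotentialBound (Δ σ) σ ⟨ x σ , relabelAt (d σ) i , Δ σ ⟩ 0
    relabel-bound {σ} {i} inv sel = begin
      + 0 + potential (x σ) (relabelAt (d σ) i)
        ≡⟨ cong (_+_ (+ 0)) (potential-relabel (x σ) (d σ) i≢s i≢t) ⟩
      + 0 + (Φ σ + excess (x σ) i)
        ≤⟨ ℤP.+-monoʳ-≤ (+ 0) (ℤP.+-monoʳ-≤ (Φ σ) (excess≤Δ inv i i≢s i≢t)) ⟩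
      + 0 + (Φ σ + + Δ σ)
        ≡⟨ one-relabel (Φ σ) (+ Δ σ) (Λ σ) ⟩
      Φ σ + + Δ σ * ((Λ σ + + 1) - Λ σ)
        ≡⟨ cong (λ L → Φ σ + + Δ σ * (L - Λ σ)) (labelSum-relabel (d σ) i≢s i≢t) ⟨
      Φ σ + + Δ σ * (labelSum (relabelAt (d σ) i) - Λ σ) ∎
      where
      open ℤP.≤-Reasoning
      i≢s = proj₁ (selected-internal sel)
      i≢t = proj₂ (selected-internal sel)
      one-relabel : ∀ P D L → + 0 + (P + D) ≡ P + D * ((L + + 1) - L)
      one-relabel = solve-∀

    step-bound : ∀ {σ σ′ a} → Invariant σ → Step σ σ′ a → PotentialBound (Δ σ) σ σ′ a
    step-bound inv (push σ i j δ sel adm _) = push-bound sel adm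
    step-bound inv (relabel σ i sel _)     = relabel-bound inv sel

    bound-trans : ∀ {D σ σ′ σ″ a b} → PotentialBound D σ σ′ a → PotentialBound D σ′ σ″ b →
                  PotentialBound D σ σ″ (a ℕ.+ b)
    bound-trans {D} {σ} {σ′} {σ″} {a} {b} bound₁ bound₂ = begin
      + a + + b + Φ σ″                      ≡⟨ ℤP.+-assoc (+ a) (+ b) (Φ σ″) ⟩
      + a + (+ b + Φ σ″)                    ≤⟨ ℤP.+-monoʳ-≤ (+ a) bound₂ ⟩
      + a + (Φ σ′ + + D * (Λ σ″ - Λ σ′))    ≡⟨ ℤP.+-assoc (+ a) (Φ σ′) _ ⟨
      + a + Φ σ′ + + D * (Λ σ″ - Λ σ′)      ≤⟨ ℤP.+-monoˡ-≤ (+ D * (Λ σ″ - Λ σ′)) bound₁ ⟩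
      Φ σ + + D * (Λ σ′ - Λ σ) + + D * (Λ σ″ - Λ σ′)  ≡⟨ telescope (Φ σ) (+ D) (Λ σ) (Λ σ′) (Λ σ″) ⟩
      Φ σ + + D * (Λ σ″ - Λ σ)              ∎
      where
      open ℤP.≤-Reasoning
      telescope : ∀ P D L L′ L″ → P + D * (L′ - L) + D * (L″ - L′) ≡ P + D * (L″ - L)
      telescope = solve-∀

    step-keeps-Δ : ∀ {σ σ′ a} → Step σ σ′ a → Δ σ′ ≡ Δ σ
    step-keeps-Δ (push _ _ _ _ _ _ _) = refl
    step-keeps-Δ (relabel _ _ _ _)    = refl

    steps-bound : ∀ {σ σ′ a} → Invariant σ → Steps σ σ′ a → Invariant σ′ × PotentialBound (Δ σ) σ σ′ a
    steps-bound {σ} inv (done σ) = inv , ℤP.≤-reflexive (no-change (Φ σ) (+ Δ σ) (Λ σ))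
      where
      no-change : ∀ P D L → + 0 + P ≡ P + D * (L - L)
      no-change = solve-∀
    steps-bound {σ} inv (_∷_ {σ' = σ′} {σ'' = σ″} {b = b} st sts) with steps-bound (step-preserves inv st) sts
    ... | inv″ , bound = inv″ , bound-trans {Δ σ} {σ} {σ′} {σ″} (step-bound inv st)
                                   (subst (λ D → PotentialBound D σ′ σ″ b) (step-keeps-Δ st) bound)

    potential≥0 : ∀ {σ} → Invariant σ → 0ℤ ℤ.≤ Φ σ
    potential≥0 {σ} inv = ∑-nonNeg term≥0
      where
      term≥0 : ∀ a → 0ℤ ℤ.≤ excess (x σ) a * + internalLabel (d σ) a
      term≥0 a with internalLabel-view (d σ) a
      ... | inj₁ zero-label rewrite zero-label = ℤP.≤-reflexive (sym (ℤP.*-zeroʳ (excess (x σ) a)))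
      ... | inj₂ (a≢s , _ , _) = ℤP.*-monoʳ-≤-nonNeg (+ internalLabel (d σ) a) (preflow inv a a≢s)

    potential≤Δ*labelSum : ∀ {σ} → Invariant σ → Φ σ ℤ.≤ + Δ σ * Λ σ
    potential≤Δ*labelSum {σ} inv =
      ℤP.≤-trans (∑-mono-≤ term≤)
                 (ℤP.≤-reflexive (sym (*-distribˡ-sum (+ Δ σ) (λ a → + internalLabel (d σ) a))))
      where
      term≤ : ∀ a → excess (x σ) a * + internalLabel (d σ) a ℤ.≤ + Δ σ * + internalLabel (d σ) a
      term≤ a with internalLabel-view (d σ) a
      ... | inj₁ zero-label rewrite zero-label =
        ℤP.≤-reflexive (trans (ℤP.*-zeroʳ (excess (x σ) a)) (sym (ℤP.*-zeroʳ (+ Δ σ))))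
      ... | inj₂ (a≢s , a≢t , _) = ℤP.*-monoʳ-≤-nonNeg (+ internalLabel (d σ) a) (excess≤Δ inv a a≢s a≢t)

    labelSum+2n≤n*2n : ∀ {σ} → Invariant σ → Λ σ + + (n ℕ.+ n) ℤ.≤ + n * + (n ℕ.+ n)
    labelSum+2n≤n*2n {σ} inv =
      ∑+c≤m*c s (ℤ.+≤+ (ℕP.≤-reflexive (internalLabel-s (d σ))))
                   (λ a → ℤ.+≤+ (ℕP.≤-trans (internalLabel≤label (d σ) a) (label≤2n inv a)))

    pushed≤Δ*labelSum : ∀ {σ σ′ a} → Invariant σ → Invariant σ′ → PotentialBound (Δ σ) σ σ′ a →
                        + a ℤ.≤ + Δ σ * Λ σ′
    pushed≤Δ*labelSum {σ} {σ′} {a} inv inv′ bound = begin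
      + a                                ≡⟨ ℤP.+-identityʳ (+ a) ⟨
      + a + 0ℤ                           ≤⟨ ℤP.+-monoʳ-≤ (+ a) (potential≥0 inv′) ⟩
      + a + Φ σ′                         ≤⟨ bound ⟩
      Φ σ + + Δ σ * (Λ σ′ - Λ σ)         ≤⟨ ℤP.+-monoˡ-≤ (+ Δ σ * (Λ σ′ - Λ σ)) (potential≤Δ*labelSum inv) ⟩
      + Δ σ * Λ σ + + Δ σ * (Λ σ′ - Λ σ) ≡⟨ telescope (+ Δ σ) (Λ σ) (Λ σ′) ⟩
      + Δ σ * Λ σ′                       ∎
      where
      open ℤP.≤-Reasoning
      telescope : ∀ D L L′ → D * L + D * (L′ - L) ≡ D * L′
      telescope = solve-∀

open import Data.Nat using (ℕ; _*_; _^_; _<_)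
open import Data.Product using (proj₁; proj₂)
open PhaseAnalysis using (pushed<2n²Δ; module Phase)

lemma5p1 : ∀ {n} (N : Network n) (p : ℕ) (σ σ' : State n) (amount : ℕ) →
           LMES.PhaseStart N (2 ^ p) σ →
           LMES.Steps N (2 ^ p) σ σ' amount →
           amount < 2 * n ^ 2 * Δ σ
lemma5p1 N p σ σ' amount start steps =
  pushed<2n²Δ (Invariant.Δ≥1 inv) n≥1 (pushed≤Δ*labelSum inv inv′ bound) (labelSum+2n≤n*2n inv′)
  where
  open Phase N (2 ^ p)
  inv : Invariant σ
  inv = phaseStart-invariant start
  inv′ : Invariant σ'
  inv′ = proj₁ (steps-bound inv steps)
  bound : PotentialBound (Δ σ) σ σ' amount
  bound = proj₂ (steps-bound inv steps)
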